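{- Let $R : X \leftrightarrow \mathcal{P} Y$ and $S : Y \leftrightarrow \mathcal{P} Z$ be multirelations. Then (1) $\delta_i(R) \ast S = \alpha(R)\, S$ (relational composition of the relation $\alpha(R) : X \leftrightarrow Y$ with $S$); (2) $\delta_i(R \ast S) \subseteq \delta_i(R) \ast \delta_i(S)$; (3) $\delta_o(R \ast S) \sqsubseteq_\updownarrow \delta_o(R) \ast \delta_o(S)$.
   Context: Multirelations $R : X \leftrightarrow \mathcal{P} Y$ are subsets of $X \times \mathcal{P} Y$; relational composition $TS = \{(a,c) \mid \exists b.\ (a,b)\in T\wedge (b,c)\in S\}$. $\alpha(R) = \{(a,b) \mid \exists B.\ (a,B)\in R\wedge b\in B\}$; $\Lambda(T) = \{(a,T(a))\mid a\in X\}$; $\eta(T) = \{(a,\{b\}) \mid (a,b)\in T\}$; $\delta_o = \Lambda\circ\alpha$, $\delta_i = \eta\circ\alpha$. Peleg composition: $R \ast S = \{(a,C) \mid \exists B.\ (a,B) \in R \wedge \exists f : Y \to \mathcal{P} Z.\ (\forall b \in B.\ (b,f(b)) \in S) \wedge C = \bigcup_{b \in B} f(b)\}$. Up-closure ${\uparrow}R = \{(a,A)\mid \exists B.\ (a,B)\in R\wedge B\subseteq A\}$, down-closure ${\downarrow}R = \{(a,A)\mid \exists B.\ (a,B)\in R\wedge A\subseteq B\}$; Egli-Milner preorder $R \sqsubseteq_\updownarrow S \Leftrightarrow R \subseteq {\downarrow}S \wedge S \subseteq {\uparrow}R$. -}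

module Defs where

open import Data.Unit using (⊤; tt)
open import Data.Product using (Σ; ∃; ∃-syntax; _×_; _,_)
open import Relation.Binary.PropositionalEquality using (_≡_)

𝒫 : Set → Set₁
𝒫 Y = Y → Set

_⊆ₛ_ : {Y : Set} → 𝒫 Y → 𝒫 Y → Set
A ⊆ₛ B = ∀ y → A y → B y

_≐_ : {Y : Set} → 𝒫 Y → 𝒫 Y → Set
A ≐ B = (A ⊆ₛ B) × (B ⊆ₛ A)

｛_｝ : {Y : Set} → Y → 𝒫 Y
｛ b ｝ = λ y → y ≡ b

Rel : Set → Set → Set₁
Rel X Y = X → Y → Set

-- A subset of X × 𝒫 Y is encoded (predicatively) by giving, for each
-- a ∈ X, a family of subsets of Y: (a , B) ∈ R  iff  B equals (as a set)
-- some member  set a i  of the family at a.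

record MRel (X Y : Set) : Set₁ where
  field
    Idx : X → Set
    set : (a : X) → Idx a → 𝒫 Y
open MRel public

_∋⟨_,_⟩ : {X Y : Set} → MRel X Y → X → 𝒫 Y → Set
R ∋⟨ a , B ⟩ = ∃[ i ] (set R a i ≐ B)

_⊆ᴹ_ : {X Y : Set} → MRel X Y → MRel X Y → Set₁
R ⊆ᴹ S = ∀ a B → R ∋⟨ a , B ⟩ → S ∋⟨ a , B ⟩

_≡ᴹ_ : {X Y : Set} → MRel X Y → MRel X Y → Set₁
R ≡ᴹ S = (R ⊆ᴹ S) × (S ⊆ᴹ R)

α : {X Y : Set} → MRel X Y → Rel X Y
α R a b = ∃[ i ] set R a i b

Λ : {X Y : Set} → Rel X Y → MRel X Y
Λ T = record { Idx = λ _ → ⊤ ; set = λ a _ → T a }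

η : {X Y : Set} → Rel X Y → MRel X Y
η T = record { Idx = λ a → ∃[ b ] T a b ; set = λ a p → ｛ Σ.proj₁ p ｝ }

δₒ : {X Y : Set} → MRel X Y → MRel X Y
δₒ R = Λ (α R)

δᵢ : {X Y : Set} → MRel X Y → MRel X Y
δᵢ R = η (α R)

_⨾_ : {X Y Z : Set} → Rel X Y → MRel Y Z → MRel X Z
T ⨾ S = record
  { Idx = λ a → ∃[ b ] (T a b × Idx S b)
  ; set = λ a p → set S (Σ.proj₁ p) (Σ.proj₂ (Σ.proj₂ p)) }

-- Peleg composition:
-- (a , C) ∈ R ∗ S  iff  ∃ B. (a,B) ∈ R ∧ ∃ f. (∀ b ∈ B. (b, f b) ∈ S)
--                        ∧ C = ⋃_{b ∈ B} f b.
-- Index: a member B = set R a i of R at a, together with a choice g of,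
-- for each b ∈ B, a member f b = set S b (g b p) of S at b.
_∗_ : {X Y Z : Set} → MRel X Y → MRel Y Z → MRel X Z
R ∗ S = record
  { Idx = λ a → Σ (Idx R a) λ i → (b : _) → set R a i b → Idx S b
  ; set = λ a ig c → ∃[ b ] Σ (set R a (Σ.proj₁ ig) b) λ p →
                        set S b (Σ.proj₂ ig b p) c }

_∋↑⟨_,_⟩ : {X Y : Set} → MRel X Y → X → 𝒫 Y → Set₁
R ∋↑⟨ a , A ⟩ = Σ (𝒫 _) λ B → (R ∋⟨ a , B ⟩) × (B ⊆ₛ A)

_∋↓⟨_,_⟩ : {X Y : Set} → MRel X Y → X → 𝒫 Y → Set₁
R ∋↓⟨ a , A ⟩ = Σ (𝒫 _) λ B → (R ∋⟨ a , B ⟩) × (A ⊆ₛ B)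

_⊑↕_ : {X Y : Set} → MRel X Y → MRel X Y → Set₁
R ⊑↕ S = (∀ a A → R ∋⟨ a , A ⟩ → S ∋↓⟨ a , A ⟩)
       × (∀ a A → S ∋⟨ a , A ⟩ → R ∋↑⟨ a , A ⟩)

{-# OPTIONS --safe #-}

-- When the first factor of a Peleg composition only offers singletons, the
-- union it takes is over a singleton, so η T ∗ S = T ⨾ S. Since moreover
-- α (R ∗ S) ⊆ α R ⨟ α S and Λ T ∗ Λ U = Λ (T ⨟ U), all three parts reduce to
-- monotonicity of η and Λ.
module Submission where

open import Defs
open import Data.Product using (_×_; ∃-syntax; Σ; _,_; proj₁; proj₂)
open import Data.Unit using (tt)
open import Relation.Binary.Core using (_⇒_)
open import Relation.Binary.PropositionalEquality using (_≡_; refl; sym; subst)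

private
  variable
    X Y Z : Set

_⨟_ : Rel X Y → Rel Y Z → Rel X Z
(T ⨟ U) a c = ∃[ b ] T a b × U b c

≐-refl : {A : 𝒫 Y} → A ≐ A
≐-refl = (λ _ x → x) , (λ _ x → x)

≐-sym : {A B : 𝒫 Y} → A ≐ B → B ≐ A
≐-sym (A⊆B , B⊆A) = B⊆A , A⊆B

≐-trans : {A B C : 𝒫 Y} → A ≐ B → B ≐ C → A ≐ C
≐-trans (A⊆B , B⊆A) (B⊆C , C⊆B) =
  (λ y a → B⊆C y (A⊆B y a)) , (λ y c → B⊆A y (C⊆B y c))

⊆ᴹ-trans : {P Q R : MRel X Y} → P ⊆ᴹ Q → Q ⊆ᴹ R → P ⊆ᴹ R
⊆ᴹ-trans P⊆Q Q⊆R a B p = Q⊆R a B (P⊆Q a B p)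

⊑↕-respʳ-≡ᴹ : {P Q Q′ : MRel X Y} → P ⊑↕ Q → Q ≡ᴹ Q′ → P ⊑↕ Q′
⊑↕-respʳ-≡ᴹ (P⊆↓Q , Q⊆↑P) (Q⊆Q′ , Q′⊆Q) =
  (λ a A p → let (B , q , A⊆B) = P⊆↓Q a A p in B , Q⊆Q′ a B q , A⊆B) ,
  (λ a A q′ → Q⊆↑P a A (Q′⊆Q a A q′))

⋃-｛｝ : {b : Y} (F : (b′ : Y) → b′ ≡ b → 𝒫 Z) →
        (λ c → ∃[ b′ ] Σ (b′ ≡ b) λ q → F b′ q c) ≐ F b refl
⋃-｛｝ F = (λ { c (_ , refl , x) → x }) , (λ c x → _ , refl , x)

η-mono : {T U : Rel X Y} → T ⇒ U → η T ⊆ᴹ η U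
η-mono T⇒U a B ((b , t) , e) = (b , T⇒U t) , e

η-∗ : (T : Rel X Y) (S : MRel Y Z) → (η T ∗ S) ≡ᴹ (T ⨾ S)
η-∗ T S = η∗S⊆T⨾S , T⨾S⊆η∗S
  where
  η∗S⊆T⨾S : (η T ∗ S) ⊆ᴹ (T ⨾ S)
  η∗S⊆T⨾S a C (((b , t) , g) , e) =
    (b , t , g b refl) , ≐-trans (≐-sym (⋃-｛｝ λ b′ q → set S b′ (g b′ q))) e

  T⨾S⊆η∗S : (T ⨾ S) ⊆ᴹ (η T ∗ S)
  T⨾S⊆η∗S a C ((b , t , j) , e) =
    ((b , t) , g) , ≐-trans (⋃-｛｝ λ b′ q → set S b′ (g b′ q)) e
    where
    g : ∀ b′ → b′ ≡ b → Idx S b′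
    g b′ q = subst (Idx S) (sym q) j

η-compose-⊆ : (T : Rel X Y) (U : Rel Y Z) → η (T ⨟ U) ⊆ᴹ (T ⨾ η U)
η-compose-⊆ _ _ a C ((c , b , t , u) , e) = (b , t , c , u) , e

Λ-mono-⊑↕ : {T U : Rel X Y} → T ⇒ U → Λ T ⊑↕ Λ U
Λ-mono-⊑↕ {T = T} {U} T⇒U =
  (λ a A (_ , e) → U a , (tt , ≐-refl) , λ y x → T⇒U (proj₂ e y x)) ,
  (λ a A (_ , e) → T a , (tt , ≐-refl) , λ y x → proj₁ e y (T⇒U x))

Λ-compose : (T : Rel X Y) (U : Rel Y Z) → Λ (T ⨟ U) ≡ᴹ (Λ T ∗ Λ U)
Λ-compose _ _ =
  (λ a C (_ , e) → (tt , λ _ _ → tt) , e) ,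
  (λ a C (_ , e) → tt , e)

α-∗-⇒ : (R : MRel X Y) (S : MRel Y Z) → α (R ∗ S) ⇒ (α R ⨟ α S)
α-∗-⇒ R S ((i , g) , b , p , s) = b , (i , p) , (g b p , s)

lemma3p18 : {X Y Z : Set} (R : MRel X Y) (S : MRel Y Z)
    → ((δᵢ R ∗ S) ≡ᴹ (α R ⨾ S))
      × ((δᵢ (R ∗ S) ⊆ᴹ (δᵢ R ∗ δᵢ S))
      × (δₒ (R ∗ S) ⊑↕ (δₒ R ∗ δₒ S)))
lemma3p18 R S =
  η-∗ (α R) S ,
  ⊆ᴹ-trans (η-mono (α-∗-⇒ R S))
    (⊆ᴹ-trans (η-compose-⊆ (α R) (α S)) (proj₂ (η-∗ (α R) (δᵢ S)))) ,
  ⊑↕-respʳ-≡ᴹ (Λ-mono-⊑↕ (α-∗-⇒ R S)) (Λ-compose (α R) (α S))
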